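{- Let $T$ be a tree of order $m\geq 2$ and $C$ a cycle of order $n\geq 3$. Then $$\operatorname{dem}(T\Box C)=\begin{cases} n & \text{if } n\geq 2m+1,\\ 2m & \text{if } n\leq 2m.\end{cases}$$
   Context: For a graph $X$, a set $M\subseteq V(X)$ and an edge $e\in E(X)$, $P_X(M,e)$ is the set of pairs $(x,y)$ with $x\in M$, $y\in V(X)$ such that $d_X(x,y)\neq d_{X-e}(x,y)$. An edge $e$ is monitored by $x$ if $P_X(\{x\},e)\ne\emptyset$. A distance-edge-monitoring set is a set $M$ such that every edge is monitored by some vertex of $M$; $\operatorname{dem}(X)$ is the minimum size of such a set. $\Box$ denotes the Cartesian product of graphs. -}

module Defs where

open import Data.Nat using (ℕ; zero; suc; _≤_; _<_; _∸_)
open import Data.Fin using (Fin; toℕ; fromℕ; zero)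
open import Data.Fin.Properties using () renaming (_≟_ to _≟ᶠ_)
open import Data.Bool using (Bool; true; false; _∧_; _∨_; not)
open import Data.Product using (Σ; ∃; _×_; _,_)
open import Data.Product.Properties using (≡-dec)
open import Data.List using (List; length)
open import Data.List.Membership.Propositional using (_∈_)
open import Data.List.Relation.Unary.Unique.Propositional using (Unique)
open import Relation.Binary.PropositionalEquality using (_≡_; _≢_)
open import Relation.Binary.Definitions using (DecidableEquality)
open import Relation.Nullary using (¬_)
open import Relation.Nullary.Decidable using (⌊_⌋)
import Data.Nat as ℕ

Adj : Set → Set
Adj V = V → V → Bool

IsSimple : {V : Set} → Adj V → Set
IsSimple {V} A = (∀ x y → A x y ≡ A y x) × (∀ x → A x x ≡ false)

data Walk {V : Set} (A : Adj V) : V → V → ℕ → Set where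
  nil  : ∀ {x} → Walk A x x 0
  cons : ∀ {x z y k} → A x z ≡ true → Walk A z y k → Walk A x y (suc k)

Dist : {V : Set} → Adj V → V → V → ℕ → Set
Dist A x y k = Walk A x y k × (∀ j → j < k → ¬ Walk A x y j)

-- d_A(x,y) = d_B(x,y) (both infinite counts as equal).
SameDist : {V : Set} → Adj V → Adj V → V → V → Set
SameDist A B x y = ∀ k → (Dist A x y k → Dist B x y k) × (Dist B x y k → Dist A x y k)

Connected : {V : Set} → Adj V → Set
Connected A = ∀ x y → ∃ λ k → Walk A x y k

Edge : {V : Set} → Adj V → Set
Edge {V} A = Σ V λ u → Σ V λ v → A u v ≡ true

deleteEdge : {V : Set} → DecidableEquality V → Adj V → V → V → Adj V
deleteEdge _≟_ A u v a b =
  A a b ∧ not ((⌊ a ≟ u ⌋ ∧ ⌊ b ≟ v ⌋) ∨ (⌊ a ≟ v ⌋ ∧ ⌊ b ≟ u ⌋))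

Monitors : {V : Set} → DecidableEquality V → (A : Adj V) → V → Edge A → Set
Monitors {V} eq A x (u , v , _) = Σ V λ y → ¬ SameDist A (deleteEdge eq A u v) x y

IsDEMSet : {V : Set} → DecidableEquality V → Adj V → List V → Set
IsDEMSet eq A M = (e : Edge A) → Σ _ λ x → x ∈ M × Monitors eq A x e

DemIs : {V : Set} → DecidableEquality V → Adj V → ℕ → Set
DemIs eq A k =
  (Σ _ λ M → Unique M × IsDEMSet eq A M × length M ≡ k)
  × (∀ M → Unique M → IsDEMSet eq A M → k ≤ length M)

-- A cycle subgraph: an injective cyclic sequence f 0, ..., f (r+2) of r+3 vertices,
-- consecutive ones adjacent and f (r+2) adjacent to f 0.
ContainsCycle : {V : Set} → Adj V → Set
ContainsCycle {V} A =
  Σ ℕ λ r → Σ (Fin (suc (suc (suc r))) → V) λ f →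
    (∀ i j → f i ≡ f j → i ≡ j)
    × (∀ i j → suc (toℕ i) ≡ toℕ j → A (f i) (f j) ≡ true)
    × (A (f (fromℕ (suc (suc r)))) (f zero) ≡ true)

IsTree : {V : Set} → Adj V → Set
IsTree A = IsSimple A × Connected A × ¬ ContainsCycle A

-- The cycle C_n on vertices 0, ..., n-1 (i ~ i+1 mod n).
cycleAdj : (n : ℕ) → Adj (Fin n)
cycleAdj n i j = step i j ∨ step j i
  where
  step : Fin n → Fin n → Bool
  step a b = (suc (toℕ a) ℕ.≡ᵇ toℕ b) ∨ ((suc (toℕ a) ℕ.≡ᵇ n) ∧ (toℕ b ℕ.≡ᵇ 0))

_□_ : {V W : Set} → DecidableEquality V → DecidableEquality W → Adj V → Adj W → Adj (V × W)
(_□_ eqV eqW A B) (a , b) (c , d) = (A a c ∧ ⌊ eqW b d ⌋) ∨ (⌊ eqV a c ⌋ ∧ B b d)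

infixl 5 _□_

decFin : ∀ {n} → DecidableEquality (Fin n)
decFin = _≟ᶠ_

decFinPair : ∀ {m n} → DecidableEquality (Fin m × Fin n)
decFinPair = ≡-dec _≟ᶠ_ _≟ᶠ_

prodFin : ∀ {m n} → Adj (Fin m) → Adj (Fin n) → Adj (Fin m × Fin n)
prodFin A B = _□_ decFin decFin A B

module Submission where

-- Write P = T □ C_n; its layers are the copies T × {c} and its fibers the cycles {t} × C_n.
-- A walk leaving a vertex can make its cycle moves before its tree moves or after them, so
-- only vertices of the same layer (resp. fiber) can monitor an edge of a layer (resp. fiber).
-- Every vertex of a layer monitors all of its edges, since tree edges are bridges; in a fiber,
-- a vertex monitors every edge not roughly opposite to it but not the edge at its antipode.
-- So a monitoring set meets all n layers and has two vertices in each of the m fibers, and,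
-- conversely, meeting every layer with two suitably spread vertices per fiber suffices: the
-- diagonal {(c mod m, c)} does this when n ≥ 2m + 1, and the pairs {(t, tₙ), (t, tₙ + ⌊n/2⌋)} with
-- tₙ = t mod n do it when n ≤ 2m.

open import Defs
open import Data.Bool using (Bool; true; false; _∧_; _∨_; not)
open import Data.Bool.Properties using (T-≡; ∨-comm; ∨-zeroʳ) renaming (_≟_ to _≟ᵇ_)
open import Data.Empty using (⊥-elim)
open import Data.Fin using (Fin; toℕ; fromℕ; fromℕ<; zero; suc; remQuot; combine)
open import Data.Fin.Properties
  using (any?; toℕ-injective; toℕ-fromℕ<; toℕ<n; injective⇒≤; combine-remQuot; remQuot-combine)
  renaming (_≟_ to _≟ᶠ_)
open import Data.Nat
  using (ℕ; zero; suc; NonZero; _≤_; _<_; _+_; _*_; _∸_; _⊓_; _%_; _/_; ∣_-_∣; _≡ᵇ_; z≤n; s≤s; s≤s⁻¹)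
open import Data.Nat.Properties
open import Data.Nat.DivMod
open import Data.Nat.Solver using (module +-*-Solver)
open +-*-Solver using (solve; _:+_; _:=_)
open import Data.List using (List; length; lookup; tabulate)
open import Data.List.Properties using (length-tabulate)
open import Data.List.Membership.Propositional using (_∈_)
open import Data.List.Membership.Propositional.Properties using (∈-tabulate⁺)
open import Data.List.Relation.Unary.Any using (index)
open import Data.List.Relation.Unary.Any.Properties using (lookup-index)
open import Data.List.Relation.Unary.Unique.Propositional using (Unique)
open import Data.List.Relation.Unary.Unique.Propositional.Properties using (tabulate⁺)
open import Data.Product using (Σ; _×_; _,_; proj₁; proj₂; uncurry)
open import Data.Sum using (_⊎_; inj₁; inj₂)
open import Function using (id)
open import Function.Bundles using (Equivalence)
open import Relation.Binary.Definitions using (DecidableEquality; tri<; tri≈; tri>)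
open import Relation.Binary.PropositionalEquality
open import Relation.Nullary using (¬_; Dec; yes; no; does)
open import Relation.Nullary.Decidable using (⌊_⌋; _×-dec_; _⊎-dec_; isYes≗does)

-- Booleans and arithmetic

∨-true⁻ : ∀ x {y} → x ∨ y ≡ true → x ≡ true ⊎ y ≡ true
∨-true⁻ true _ = inj₁ refl
∨-true⁻ false e = inj₂ e

∧-true⁻ : ∀ x {y} → x ∧ y ≡ true → x ≡ true × y ≡ true
∧-true⁻ true e = refl , e

≡ᵇ-true⁻ : ∀ a b → (a ≡ᵇ b) ≡ true → a ≡ b
≡ᵇ-true⁻ a b e = ≡ᵇ⇒≡ a b (Equivalence.from T-≡ e)

≡ᵇ-true⁺ : ∀ a b → a ≡ b → (a ≡ᵇ b) ≡ true
≡ᵇ-true⁺ a b a≡b = Equivalence.to T-≡ (≡⇒≡ᵇ a b a≡b)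

isYes-true⁻ : ∀ {P : Set} (p? : Dec P) → ⌊ p? ⌋ ≡ true → P
isYes-true⁻ (yes p) _ = p

∧-not-true⁻ : ∀ {P : Set} b (p? : Dec P) → b ∧ not (does p?) ≡ true → b ≡ true × ¬ P
∧-not-true⁻ true (no ¬p) _ = refl , ¬p
∧-not-true⁻ true (yes _) ()
∧-not-true⁻ false _ ()

∧-not-true⁺ : ∀ {P : Set} {b} (p? : Dec P) → b ≡ true → ¬ P → b ∧ not (does p?) ≡ true
∧-not-true⁺ (yes p) _ ¬p = ⊥-elim (¬p p)
∧-not-true⁺ (no _) refl _ = refl

double-≤-cancel : ∀ {a b} → a + a ≤ suc (b + b) → a ≤ b
double-≤-cancel {a} {b} a+a≤1+2b with a ≤? b
... | yes a≤b = a≤b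
... | no a≰b = ⊥-elim (<-irrefl refl (≤-trans (s≤s (≤-reflexive (sym (+-suc b b))))
  (≤-trans (+-mono-≤ (≰⇒> a≰b) (≰⇒> a≰b)) a+a≤1+2b)))

∸-suc : ∀ {a b} → a < b → b ∸ a ≡ suc (b ∸ suc a)
∸-suc {zero} {suc b} _ = refl
∸-suc {suc a} {suc b} (s≤s a<b) = ∸-suc a<b

∣1+u-q∣-step : ∀ u q → ∣ suc u - q ∣ ≤ suc ∣ u - q ∣ × ∣ u - q ∣ ≤ suc ∣ suc u - q ∣
∣1+u-q∣-step zero zero = ≤-refl , z≤n
∣1+u-q∣-step (suc u) zero = ≤-refl , ≤-trans (n≤1+n (suc u)) (n≤1+n _)
∣1+u-q∣-step zero (suc q) = ≤-trans (n≤1+n q) (n≤1+n _) , ≤-refl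
∣1+u-q∣-step (suc u) (suc q) = ∣1+u-q∣-step u q

3≤h+h⇒2≤h : ∀ h → 3 ≤ h + h → 2 ≤ h
3≤h+h⇒2≤h (suc (suc _)) _ = s≤s (s≤s z≤n)
3≤h+h⇒2≤h (suc zero) (s≤s (s≤s ()))

toℕ-mod : ∀ n .{{_ : NonZero n}} a → toℕ (a mod n) ≡ a % n
toℕ-mod n a = toℕ-fromℕ< (m%n<n a n)

module _ (n : ℕ) .{{_ : NonZero n}} where

  [a%n+b]%n≡[a+b]%n : ∀ a b → (a % n + b) % n ≡ (a + b) % n
  [a%n+b]%n≡[a+b]%n a b = begin
    (a % n + b) % n         ≡⟨ %-distribˡ-+ (a % n) b n ⟩
    (a % n % n + b % n) % n ≡⟨ cong (λ z → (z + b % n) % n) (m%n%n≡m%n a n) ⟩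
    (a % n + b % n) % n     ≡⟨ %-distribˡ-+ a b n ⟨
    (a + b) % n             ∎
    where open ≡-Reasoning

  [a+b%n]%n≡[a+b]%n : ∀ a b → (a + b % n) % n ≡ (a + b) % n
  [a+b%n]%n≡[a+b]%n a b = begin
    (a + b % n) % n ≡⟨ cong (_% n) (+-comm a (b % n)) ⟩
    (b % n + a) % n ≡⟨ [a%n+b]%n≡[a+b]%n b a ⟩
    (b + a) % n     ≡⟨ cong (_% n) (+-comm b a) ⟩
    (a + b) % n     ∎
    where open ≡-Reasoning

  %-below-double : ∀ s t → s < n + n → s % n ≡ t → s ≡ t ⊎ s ≡ n + t
  %-below-double s t s<2n s%n≡t with s <? n
  ... | yes s<n = inj₁ (trans (sym (m<n⇒m%n≡m s<n)) s%n≡t)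
  ... | no s≮n = inj₂ (begin
    s           ≡⟨ m∸n+n≡m n≤s ⟨
    s ∸ n + n   ≡⟨ cong (_+ n) s∸n≡t ⟩
    t + n       ≡⟨ +-comm t n ⟩
    n + t       ∎)
    where
    open ≡-Reasoning
    n≤s : n ≤ s
    n≤s = ≮⇒≥ s≮n
    s∸n<n : s ∸ n < n
    s∸n<n = +-cancelʳ-< n (s ∸ n) n (subst (_< n + n) (sym (m∸n+n≡m n≤s)) s<2n)
    s∸n≡t : s ∸ n ≡ t
    s∸n≡t = begin
      s ∸ n           ≡⟨ m<n⇒m%n≡m s∸n<n ⟨
      (s ∸ n) % n     ≡⟨ [m+n]%n≡m%n (s ∸ n) n ⟨
      (s ∸ n + n) % n ≡⟨ cong (_% n) (m∸n+n≡m n≤s) ⟩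
      s % n           ≡⟨ s%n≡t ⟩
      t               ∎

Least : (ℕ → Set) → ℕ → Set
Least P d = P d × (∀ j → j < d → ¬ P j)

least-witness : {P : ℕ → Set} → (∀ n → Dec (P n)) → ∀ {k} → P k → Σ ℕ (Least P)
least-witness {P} P? {k} = search 0 k (λ _ ())
  where
  search : ∀ i f → (∀ j → j < i → ¬ P j) → P (i + f) → Σ ℕ (Least P)
  search i f below p with P? i
  ... | yes pᵢ = i , pᵢ , below
  search i zero below p | no ¬pᵢ = ⊥-elim (¬pᵢ (subst P (+-identityʳ i) p))
  search i (suc f) below p | no ¬pᵢ = search (suc i) f below′ (subst P (+-suc i f) p)
    where
    below′ : ∀ j → j < suc i → ¬ P j
    below′ j j<1+i with m≤n⇒m<n∨m≡n (s≤s⁻¹ j<1+i)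
    ... | inj₁ j<i = below j j<i
    ... | inj₂ refl = ¬pᵢ

injective-into-list⇒≤length : ∀ {A : Set} {k} (f : Fin k → A) → (∀ {i j} → f i ≡ f j → i ≡ j) →
  ∀ {M : List A} → (∀ i → f i ∈ M) → k ≤ length M
injective-into-list⇒≤length f f-injective {M} f∈M = injective⇒≤ {f = λ i → index (f∈M i)}
  λ {i} {j} same → f-injective (trans (lookup-index (f∈M i))
    (trans (cong (lookup M) same) (sym (lookup-index (f∈M j)))))

remQuot-injective : ∀ {a} b {i j : Fin (a * b)} → remQuot {a} b i ≡ remQuot b j → i ≡ j
remQuot-injective {a} b {i} {j} eq =
  trans (sym (combine-remQuot {a} b i)) (trans (cong (uncurry combine) eq) (combine-remQuot {a} b j))

-- Graphs, walks and edge deletion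

module _ {V : Set} where

  _⊆ᵍ_ : Adj V → Adj V → Set
  A ⊆ᵍ B = ∀ a b → A a b ≡ true → B a b ≡ true

  Symmetricᵍ : Adj V → Set
  Symmetricᵍ A = ∀ a b → A a b ≡ true → A b a ≡ true

  Lipschitz : Adj V → (V → ℕ) → Set
  Lipschitz A Φ = ∀ a b → A a b ≡ true → Φ b ≤ suc (Φ a)

  Ends : V → V → V → V → Set
  Ends u v a b = (a ≡ u × b ≡ v) ⊎ (a ≡ v × b ≡ u)

  ends? : DecidableEquality V → ∀ u v a b → Dec (Ends u v a b)
  ends? _≟_ u v a b = ((a ≟ u) ×-dec (b ≟ v)) ⊎-dec ((a ≟ v) ×-dec (b ≟ u))

loopless : ∀ {V : Set} {A : Adj V} → IsSimple A → ∀ {a} → A a a ≢ true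
loopless (_ , irreflexive) {a} e with trans (sym e) (irreflexive a)
... | ()

simple⇒symmetric : ∀ {V : Set} {A : Adj V} → IsSimple A → Symmetricᵍ A
simple⇒symmetric (symmetric , _) a b e = trans (symmetric b a) e

mapʷ : ∀ {V W : Set} {A : Adj V} {B : Adj W} (f : V → W) →
  (∀ a b → A a b ≡ true → B (f a) (f b) ≡ true) →
  ∀ {x y k} → Walk A x y k → Walk B (f x) (f y) k
mapʷ f g nil = nil
mapʷ f g (cons {x} {z} e w) = cons (g x z e) (mapʷ f g w)

weakenʷ : ∀ {V : Set} {A B : Adj V} → A ⊆ᵍ B → ∀ {x y k} → Walk A x y k → Walk B x y k
weakenʷ = mapʷ id

module _ {V : Set} {A : Adj V} where

  snocʷ : ∀ {x y z k} → Walk A x y k → A y z ≡ true → Walk A x z (suc k)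
  snocʷ nil e = cons e nil
  snocʷ (cons e′ w) e = cons e′ (snocʷ w e)

  infixr 5 _++ʷ_
  _++ʷ_ : ∀ {x y z j k} → Walk A x y j → Walk A y z k → Walk A x z (j + k)
  nil ++ʷ w = w
  cons e w₁ ++ʷ w = cons e (w₁ ++ʷ w)

  reverseʷ : Symmetricᵍ A → ∀ {x y k} → Walk A x y k → Walk A y x k
  reverseʷ sym nil = nil
  reverseʷ sym (cons {x} {z} e w) = snocʷ (reverseʷ sym w) (sym x z e)

  lipschitz⇒≤length : ∀ {Φ} → Lipschitz A Φ → ∀ {x y k} → Walk A x y k → Φ y ≤ k + Φ x
  lipschitz⇒≤length L nil = ≤-refl
  lipschitz⇒≤length {Φ} L {x} {k = suc k} (cons {z = z} e w) = begin
    Φ _           ≤⟨ lipschitz⇒≤length L w ⟩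
    k + Φ z       ≤⟨ +-monoʳ-≤ k (L x z e) ⟩
    k + suc (Φ x) ≡⟨ +-suc k (Φ x) ⟩
    suc k + Φ x   ∎
    where open ≤-Reasoning

  lipschitz⇒≤length₀ : ∀ {Φ} → Lipschitz A Φ → ∀ {x y k} → Φ x ≡ 0 →
    Walk A x y k → Φ y ≤ k
  lipschitz⇒≤length₀ L {k = k} Φx≡0 w =
    ≤-trans (lipschitz⇒≤length L w) (≤-reflexive (trans (cong (k +_) Φx≡0) (+-identityʳ k)))

module _ {V : Set} {A B : Adj V} {x y : V} where

  ¬SameDist : ∀ {k} → Dist A x y k → ¬ Walk B x y k → ¬ SameDist A B x y
  ¬SameDist d ¬w same = ¬w (proj₁ (proj₁ (same _) d))

  SameDist-if-shortcuts : B ⊆ᵍ A →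
    (∀ j → Walk A x y j → Σ ℕ λ j′ → j′ ≤ j × Walk B x y j′) → SameDist A B x y
  SameDist-if-shortcuts B⊆A shortcut k = to , from
    where
    to : Dist A x y k → Dist B x y k
    to (w , minimal) with shortcut k w
    ... | j′ , j′≤k , w′ with m≤n⇒m<n∨m≡n j′≤k
    ... | inj₁ j′<k = ⊥-elim (minimal j′ j′<k (weakenʷ B⊆A w′))
    ... | inj₂ refl = w′ , λ j j<k wB → minimal j j<k (weakenʷ B⊆A wB)
    from : Dist B x y k → Dist A x y k
    from (w , minimal) = weakenʷ B⊆A w , λ j j<k wA →
      let (j′ , j′≤j , w′) = shortcut j wA in minimal j′ (≤-<-trans j′≤j j<k) w′

SameDist-congʳ : ∀ {V : Set} {A B B′ : Adj V} {x y : V} → B ⊆ᵍ B′ → B′ ⊆ᵍ B →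
  SameDist A B x y → SameDist A B′ x y
SameDist-congʳ B⊆B′ B′⊆B same k =
  (λ d → let (w , minimal) = proj₁ (same k) d in
     weakenʷ B⊆B′ w , λ j j<k w′ → minimal j j<k (weakenʷ B′⊆B w′)) ,
  (λ { (w , minimal) → proj₂ (same k)
         (weakenʷ B′⊆B w , λ j j<k w′ → minimal j j<k (weakenʷ B⊆B′ w′)) })

module EdgeDeletion {V : Set} (_≟_ : DecidableEquality V) (A : Adj V) (u v : V) where

  deleteEdge-≡ : ∀ a b → deleteEdge _≟_ A u v a b ≡ A a b ∧ not (does (ends? _≟_ u v a b))
  deleteEdge-≡ a b = cong (λ c → A a b ∧ not c) (cong₂ _∨_
    (cong₂ _∧_ (isYes≗does (a ≟ u)) (isYes≗does (b ≟ v)))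
    (cong₂ _∧_ (isYes≗does (a ≟ v)) (isYes≗does (b ≟ u))))

  deleteEdge⁻ : ∀ {a b} → deleteEdge _≟_ A u v a b ≡ true → A a b ≡ true × ¬ Ends u v a b
  deleteEdge⁻ {a} {b} e = ∧-not-true⁻ (A a b) (ends? _≟_ u v a b) (trans (sym (deleteEdge-≡ a b)) e)

  deleteEdge⁺ : ∀ {a b} → A a b ≡ true → ¬ Ends u v a b → deleteEdge _≟_ A u v a b ≡ true
  deleteEdge⁺ {a} {b} eA ¬ends =
    trans (deleteEdge-≡ a b) (∧-not-true⁺ (ends? _≟_ u v a b) eA ¬ends)

  deleteEdge⊆ : deleteEdge _≟_ A u v ⊆ᵍ A
  deleteEdge⊆ a b e = proj₁ (deleteEdge⁻ e)

  deleteEdge-removes : ¬ deleteEdge _≟_ A u v u v ≡ true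
  deleteEdge-removes e = proj₂ (deleteEdge⁻ e) (inj₁ (refl , refl))

  deleteEdge-symmetric : Symmetricᵍ A → Symmetricᵍ (deleteEdge _≟_ A u v)
  deleteEdge-symmetric sym a b e with deleteEdge⁻ e
  ... | eA , ¬ends = deleteEdge⁺ (sym a b eA) λ
    { (inj₁ (b≡u , a≡v)) → ¬ends (inj₂ (a≡v , b≡u))
    ; (inj₂ (b≡v , a≡u)) → ¬ends (inj₁ (a≡u , b≡v)) }

open EdgeDeletion public

deleteEdge-swap : ∀ {V : Set} (_≟_ : DecidableEquality V) (A : Adj V) (u v : V) →
  deleteEdge _≟_ A u v ⊆ᵍ deleteEdge _≟_ A v u
deleteEdge-swap _≟_ A u v a b e with deleteEdge⁻ _≟_ A u v e
... | eA , ¬ends = deleteEdge⁺ _≟_ A v u eA λ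
  { (inj₁ ends) → ¬ends (inj₂ ends) ; (inj₂ ends) → ¬ends (inj₁ ends) }

Monitorsᵉ : ∀ {V : Set} → DecidableEquality V → Adj V → V → V → V → Set
Monitorsᵉ {V} _≟_ A x u v = Σ V λ y → ¬ SameDist A (deleteEdge _≟_ A u v) x y

monitors-swap : ∀ {V : Set} (_≟_ : DecidableEquality V) (A : Adj V) {x u v} →
  Monitorsᵉ _≟_ A x u v → Monitorsᵉ _≟_ A x v u
monitors-swap _≟_ A {u = u} {v} (y , ¬same) =
  y , λ same → ¬same (SameDist-congʳ (deleteEdge-swap _≟_ A v u) (deleteEdge-swap _≟_ A u v) same)

unmonitored-if-shortcuts : ∀ {V : Set} (_≟_ : DecidableEquality V) (A : Adj V) {x u v} →
  (∀ y j → Walk A x y j → Σ ℕ λ j′ → j′ ≤ j × Walk (deleteEdge _≟_ A u v) x y j′) →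
  ¬ Monitorsᵉ _≟_ A x u v
unmonitored-if-shortcuts _≟_ A {u = u} {v} shortcut (y , ¬same) =
  ¬same (SameDist-if-shortcuts (deleteEdge⊆ _≟_ A u v) (shortcut y))

avoids-or-reaches : ∀ {V : Set} (_≟_ : DecidableEquality V) (A : Adj V) (u v : V) {x y j} →
  Walk A x y j → Walk (deleteEdge _≟_ A u v) x y j ⊎ Σ ℕ λ p → p < j × (Walk A x u p ⊎ Walk A x v p)
avoids-or-reaches _≟_ A u v nil = inj₁ nil
avoids-or-reaches _≟_ A u v (cons {x} {z} e w) with ends? _≟_ u v x z
... | yes (inj₁ (refl , _)) = inj₂ (0 , s≤s z≤n , inj₁ nil)
... | yes (inj₂ (refl , _)) = inj₂ (0 , s≤s z≤n , inj₂ nil)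
... | no ¬ends with avoids-or-reaches _≟_ A u v w
... | inj₁ w∖ = inj₁ (cons (deleteEdge⁺ _≟_ A u v e ¬ends) w∖)
... | inj₂ (p , p<j , inj₁ wᵤ) = inj₂ (suc p , s≤s p<j , inj₁ (cons e wᵤ))
... | inj₂ (p , p<j , inj₂ wᵥ) = inj₂ (suc p , s≤s p<j , inj₂ (cons e wᵥ))

module _ {m : ℕ} (A : Adj (Fin m)) where

  walk? : ∀ x y k → Dec (Walk A x y k)
  walk? x y zero with x ≟ᶠ y
  ... | yes refl = yes nil
  ... | no x≢y = no λ { nil → x≢y refl }
  walk? x y (suc k) with any? (λ z → (A x z ≟ᵇ true) ×-dec walk? z y k)
  ... | yes (z , e , w) = yes (cons e w)
  ... | no ¬step = no λ { (cons e w) → ¬step (_ , e , w) }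

  shortestWalk : ∀ {x y k} → Walk A x y k → Σ ℕ (Dist A x y)
  shortestWalk w = let (d , w′ , minimal) = least-witness (walk? _ _) w in d , w′ , minimal

module _ {V : Set} {A : Adj V} where

  vertex : ∀ {x y k} → Walk A x y k → Fin (suc k) → V
  vertex {x} w zero = x
  vertex (cons e w) (suc i) = vertex w i

  vertex-last : ∀ {x y k} (w : Walk A x y k) → vertex w (fromℕ k) ≡ y
  vertex-last nil = refl
  vertex-last (cons e w) = vertex-last w

  vertex-adjacent : ∀ {x y k} (w : Walk A x y k) (i j : Fin (suc k)) →
    suc (toℕ i) ≡ toℕ j → A (vertex w i) (vertex w j) ≡ true
  vertex-adjacent (cons e w) zero (suc zero) _ = e
  vertex-adjacent (cons e w) (suc i) (suc j) i+1≡j = vertex-adjacent w i j (suc-injective i+1≡j)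

  prefix : ∀ {x y k} (w : Walk A x y k) (i : Fin (suc k)) → Walk A x (vertex w i) (toℕ i)
  prefix w zero = nil
  prefix (cons e w) (suc i) = cons e (prefix w i)

  suffix : ∀ {x y k} (w : Walk A x y k) (i : Fin (suc k)) → Walk A (vertex w i) y (k ∸ toℕ i)
  suffix w zero = w
  suffix (cons e w) (suc i) = suffix w i

  geodesic-vertex-distinct : ∀ {x y k} (d : Dist A x y k) (i j : Fin (suc k)) →
    toℕ i < toℕ j → vertex (proj₁ d) i ≢ vertex (proj₁ d) j
  geodesic-vertex-distinct {k = k} (w , minimal) i j i<j vᵢ≡vⱼ =
    minimal (toℕ i + (k ∸ toℕ j)) shorter
      (prefix w i ++ʷ subst (λ z → Walk A z _ (k ∸ toℕ j)) (sym vᵢ≡vⱼ) (suffix w j))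
    where
    shorter : toℕ i + (k ∸ toℕ j) < k
    shorter = begin-strict
      toℕ i + (k ∸ toℕ j) <⟨ +-monoˡ-< (k ∸ toℕ j) i<j ⟩
      toℕ j + (k ∸ toℕ j) ≡⟨ m+[n∸m]≡n (s≤s⁻¹ (toℕ<n j)) ⟩
      k                   ∎
      where open ≤-Reasoning

  geodesic-vertex-injective : ∀ {x y k} (d : Dist A x y k) (i j : Fin (suc k)) →
    vertex (proj₁ d) i ≡ vertex (proj₁ d) j → i ≡ j
  geodesic-vertex-injective d i j vᵢ≡vⱼ with <-cmp (toℕ i) (toℕ j)
  ... | tri< i<j _ _ = ⊥-elim (geodesic-vertex-distinct d i j i<j vᵢ≡vⱼ)
  ... | tri≈ _ i≡j _ = toℕ-injective i≡j
  ... | tri> _ _ j<i = ⊥-elim (geodesic-vertex-distinct d j i j<i (sym vᵢ≡vⱼ))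

connected⇒edge : ∀ {V : Set} {A : Adj V} → Connected A → ∀ {x y : V} → x ≢ y →
  Σ V λ a → Σ V λ b → A a b ≡ true
connected⇒edge connected {x} {y} x≢y with connected x y
... | _ , nil = ⊥-elim (x≢y refl)
... | _ , cons e _ = x , _ , e

-- A shortest walk from t to t′ avoiding the edge t t′ closes a cycle with that edge.
tree-edge-is-bridge : ∀ {m} {T : Adj (Fin m)} → IsTree T → ∀ {t t′} → T t t′ ≡ true →
  ∀ {k} → ¬ Walk (deleteEdge decFin T t t′) t t′ k
tree-edge-is-bridge {T = T} tree {t} {t′} e w with shortestWalk (deleteEdge decFin T t t′) w
... | zero , nil , _ = loopless (proj₁ tree) e
... | suc zero , cons e′ nil , _ = deleteEdge-removes decFin T t t′ e′
... | suc (suc r) , d@(w′ , _) = proj₂ (proj₂ tree)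
  ( r , vertex w′ , geodesic-vertex-injective d
  , (λ i j i+1≡j → deleteEdge⊆ decFin T t t′ _ _ (vertex-adjacent w′ i j i+1≡j))
  , subst (λ z → T z t ≡ true) (sym (vertex-last w′)) (simple⇒symmetric (proj₁ tree) t t′ e) )

-- The cycle C_n

-- Cutting C_n at an edge leaves a path with the ends of the edge at positions 0 and n - 1;
-- the positions q below are those roughly opposite the cut.
Antipodal : ℕ → ℕ → Set
Antipodal n q = q + q ≤ n × n ≤ q + q + 2

NonAntipodal : ℕ → ℕ → Set
NonAntipodal n q = n < q + q ⊎ q + q + 2 < n

antipodal? : ∀ n q → NonAntipodal n q ⊎ Antipodal n q
antipodal? n q with n <? q + q | q + q + 2 <? n
... | yes n<2q | _ = inj₁ (inj₁ n<2q)
... | no _ | yes 2q+2<n = inj₁ (inj₂ 2q+2<n)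
... | no n≮2q | no 2q+2≮n = inj₂ (≮⇒≥ n≮2q , ≮⇒≥ 2q+2≮n)

antipodal-neighbours : ∀ {n q₁ q₂} → Antipodal n q₁ → Antipodal n q₂ → q₁ ≤ suc q₂
antipodal-neighbours {n} {q₁} {q₂} (2q₁≤n , _) (_ , n≤2q₂+2) = double-≤-cancel (begin
  q₁ + q₁               ≤⟨ ≤-trans 2q₁≤n n≤2q₂+2 ⟩
  q₂ + q₂ + 2           ≡⟨ +-comm (q₂ + q₂) 2 ⟩
  suc (suc (q₂ + q₂))   ≡⟨ cong suc (+-suc q₂ q₂) ⟨
  suc (q₂ + suc q₂)     ≤⟨ n≤1+n _ ⟩
  suc (suc q₂ + suc q₂) ∎)
  where open ≤-Reasoning

antipodal-odd : ∀ {n d} q → n ≡ suc (d + d) → Antipodal n q → q ≡ d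
antipodal-odd {n} q refl (2q≤n , n≤2q+2) = ≤-antisym (double-≤-cancel 2q≤n)
  (double-≤-cancel (s≤s⁻¹ (subst (n ≤_) (+-comm (q + q) 2) n≤2q+2)))

module Cycle (k : ℕ) where

  n : ℕ
  n = suc (suc (suc k))

  C : Adj (Fin n)
  C = cycleAdj n

  toℕ%n : ∀ (w : Fin n) → toℕ w % n ≡ toℕ w
  toℕ%n w = m<n⇒m%n≡m (toℕ<n w)

  next : Fin n → Fin n
  next w = suc (toℕ w) mod n

  infixl 6 _⊕_
  _⊕_ : Fin n → ℕ → Fin n
  c ⊕ zero = c
  c ⊕ suc r = next (c ⊕ r)

  toℕ-⊕ : ∀ c r → toℕ (c ⊕ r) ≡ (toℕ c + r) % n
  toℕ-⊕ c zero = sym (trans (cong (_% n) (+-identityʳ (toℕ c))) (toℕ%n c))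
  toℕ-⊕ c (suc r) = begin
    toℕ (next (c ⊕ r))          ≡⟨ toℕ-mod n (suc (toℕ (c ⊕ r))) ⟩
    suc (toℕ (c ⊕ r)) % n       ≡⟨ cong (λ z → suc z % n) (toℕ-⊕ c r) ⟩
    (1 + (toℕ c + r) % n) % n   ≡⟨ [a+b%n]%n≡[a+b]%n n 1 (toℕ c + r) ⟩
    suc (toℕ c + r) % n         ≡⟨ cong (_% n) (+-suc (toℕ c) r) ⟨
    (toℕ c + suc r) % n         ∎
    where open ≡-Reasoning

  compl : Fin n → ℕ
  compl x = n ∸ toℕ x

  fwd : Fin n → Fin n → ℕ
  fwd x y = (toℕ y + compl x) % n

  fwd<n : ∀ x y → fwd x y < n
  fwd<n x y = m%n<n (toℕ y + compl x) n

  toℕ+compl : ∀ x → toℕ x + compl x ≡ n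
  toℕ+compl x = m+[n∸m]≡n (<⇒≤ (toℕ<n x))

  fwd-self : ∀ x → fwd x x ≡ 0
  fwd-self x = trans (cong (_% n) (toℕ+compl x)) (n%n≡0 n)

  fwd-⊕ : ∀ x y r → fwd x (y ⊕ r) ≡ (fwd x y + r) % n
  fwd-⊕ x y r = begin
    (toℕ (y ⊕ r) + compl x) % n      ≡⟨ cong (λ z → (z + compl x) % n) (toℕ-⊕ y r) ⟩
    ((toℕ y + r) % n + compl x) % n  ≡⟨ [a%n+b]%n≡[a+b]%n n (toℕ y + r) (compl x) ⟩
    (toℕ y + r + compl x) % n        ≡⟨ cong (_% n) (swap-last (toℕ y) r (compl x)) ⟩
    (toℕ y + compl x + r) % n        ≡⟨ [a%n+b]%n≡[a+b]%n n (toℕ y + compl x) r ⟨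
    (fwd x y + r) % n                ∎
    where
    open ≡-Reasoning
    swap-last : ∀ a b c → a + b + c ≡ a + c + b
    swap-last = solve 3 (λ a b c → a :+ b :+ c := a :+ c :+ b) refl

  fwd-⊕-self : ∀ x r → fwd x (x ⊕ r) ≡ r % n
  fwd-⊕-self x r = trans (fwd-⊕ x x r) (cong (λ z → (z + r) % n) (fwd-self x))

  ⊕-fwd : ∀ x y → x ⊕ fwd x y ≡ y
  ⊕-fwd x y = toℕ-injective (begin
    toℕ (x ⊕ fwd x y)                ≡⟨ toℕ-⊕ x (fwd x y) ⟩
    (toℕ x + fwd x y) % n            ≡⟨ [a+b%n]%n≡[a+b]%n n (toℕ x) (toℕ y + compl x) ⟩
    (toℕ x + (toℕ y + compl x)) % n  ≡⟨ cong (_% n) (swap-first (toℕ x) (toℕ y) (compl x)) ⟩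
    (toℕ y + (toℕ x + compl x)) % n  ≡⟨ cong (λ z → (toℕ y + z) % n) (toℕ+compl x) ⟩
    (toℕ y + n) % n                  ≡⟨ [m+n]%n≡m%n (toℕ y) n ⟩
    toℕ y % n                        ≡⟨ toℕ%n y ⟩
    toℕ y                            ∎)
    where
    open ≡-Reasoning
    swap-first : ∀ a b c → a + (b + c) ≡ b + (a + c)
    swap-first = solve 3 (λ a b c → a :+ (b :+ c) := b :+ (a :+ c)) refl

  fwd-injective : ∀ x {y z} → fwd x y ≡ fwd x z → y ≡ z
  fwd-injective x {y} {z} eq = trans (sym (⊕-fwd x y)) (trans (cong (x ⊕_) eq) (⊕-fwd x z))

  fwd-trans : ∀ x y z → (fwd x y + fwd y z) % n ≡ fwd x z
  fwd-trans x y z = begin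
    (fwd x y + fwd y z) % n                    ≡⟨ [a%n+b]%n≡[a+b]%n n (toℕ y + compl x) _ ⟩
    (toℕ y + compl x + fwd y z) % n            ≡⟨ [a+b%n]%n≡[a+b]%n n (toℕ y + compl x) _ ⟩
    (toℕ y + compl x + (toℕ z + compl y)) % n  ≡⟨ cong (_% n) (rearrange (toℕ y) (compl x) (toℕ z) (compl y)) ⟩
    (toℕ z + compl x + (toℕ y + compl y)) % n  ≡⟨ cong (λ w → (toℕ z + compl x + w) % n) (toℕ+compl y) ⟩
    (toℕ z + compl x + n) % n                  ≡⟨ [m+n]%n≡m%n (toℕ z + compl x) n ⟩
    fwd x z                                    ∎
    where
    open ≡-Reasoning
    rearrange : ∀ a b c d → a + b + (c + d) ≡ c + b + (a + d)
    rearrange = solve 4 (λ a b c d → a :+ b :+ (c :+ d) := c :+ b :+ (a :+ d)) refl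

  fwd+fwd : ∀ x y → x ≢ y → fwd x y + fwd y x ≡ n
  fwd+fwd x y x≢y
    with %-below-double n (fwd x y + fwd y x) 0 (+-mono-< (fwd<n x y) (fwd<n y x))
           (trans (fwd-trans x y x) (fwd-self x))
  ... | inj₁ sum≡0 =
    ⊥-elim (x≢y (fwd-injective x (trans (fwd-self x) (sym (m+n≡0⇒m≡0 (fwd x y) sum≡0)))))
  ... | inj₂ sum≡n+0 = trans sum≡n+0 (+-identityʳ n)

  fwd-reverse : ∀ x y → x ≢ y → fwd y x ≡ n ∸ fwd x y
  fwd-reverse x y x≢y = trans (sym (m+n∸m≡n (fwd x y) (fwd y x))) (cong (_∸ fwd x y) (fwd+fwd x y x≢y))

  fwd-next : ∀ c a → fwd c (next a) ≡ suc (fwd c a) % n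
  fwd-next c a = trans (fwd-⊕ c a 1) (cong (_% n) (+-comm (fwd c a) 1))

  -- C i j unfolds to stepᶜ (toℕ i) (toℕ j) ∨ stepᶜ (toℕ j) (toℕ i).
  stepᶜ : ℕ → ℕ → Bool
  stepᶜ x y = (suc x ≡ᵇ y) ∨ ((suc x ≡ᵇ n) ∧ (y ≡ᵇ 0))

  stepᶜ⁻ : ∀ {x y} → y < n → stepᶜ x y ≡ true → y ≡ suc x % n
  stepᶜ⁻ {x} {y} y<n e with ∨-true⁻ (suc x ≡ᵇ y) e
  ... | inj₁ 1+x≡ᵇy = trans (sym (m<n⇒m%n≡m y<n)) (cong (_% n) (sym (≡ᵇ-true⁻ (suc x) y 1+x≡ᵇy)))
  ... | inj₂ wraps with ∧-true⁻ (suc x ≡ᵇ n) wraps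
  ... | 1+x≡ᵇn , y≡ᵇ0 =
    trans (≡ᵇ-true⁻ y 0 y≡ᵇ0) (sym (trans (cong (_% n) (≡ᵇ-true⁻ (suc x) n 1+x≡ᵇn)) (n%n≡0 n)))

  stepᶜ⁺ : ∀ {x} → x < n → stepᶜ x (suc x % n) ≡ true
  stepᶜ⁺ {x} x<n with m≤n⇒m<n∨m≡n x<n
  ... | inj₁ 1+x<n = cong (_∨ ((suc x ≡ᵇ n) ∧ (suc x % n ≡ᵇ 0)))
    (≡ᵇ-true⁺ (suc x) (suc x % n) (sym (m<n⇒m%n≡m 1+x<n)))
  ... | inj₂ 1+x≡n = trans
    (cong₂ (λ a b → (suc x ≡ᵇ suc x % n) ∨ (a ∧ b))
      (≡ᵇ-true⁺ (suc x) n 1+x≡n) (≡ᵇ-true⁺ (suc x % n) 0 (trans (cong (_% n) 1+x≡n) (n%n≡0 n))))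
    (∨-zeroʳ _)

  C-adjacent⁻ : ∀ i j → C i j ≡ true → j ≡ next i ⊎ i ≡ next j
  C-adjacent⁻ i j e with ∨-true⁻ (stepᶜ (toℕ i) (toℕ j)) e
  ... | inj₁ i→j = inj₁ (toℕ-injective
    (trans (stepᶜ⁻ (toℕ<n j) i→j) (sym (toℕ-mod n (suc (toℕ i))))))
  ... | inj₂ j→i = inj₂ (toℕ-injective
    (trans (stepᶜ⁻ (toℕ<n i) j→i) (sym (toℕ-mod n (suc (toℕ j))))))

  C-next : ∀ i → C i (next i) ≡ true
  C-next i = cong (_∨ stepᶜ (toℕ (next i)) (toℕ i))
    (subst (λ y → stepᶜ (toℕ i) y ≡ true) (sym (toℕ-mod n (suc (toℕ i)))) (stepᶜ⁺ (toℕ<n i)))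

  C-symmetric : Symmetricᵍ C
  C-symmetric a b e = trans (∨-comm (stepᶜ (toℕ b) (toℕ a)) (stepᶜ (toℕ a) (toℕ b))) e

  cycNorm : ℕ → ℕ
  cycNorm r = r ⊓ (n ∸ r)

  cycDist : Fin n → Fin n → ℕ
  cycDist c w = cycNorm (fwd c w)

  cycNorm-step : ∀ r → r < n →
    cycNorm (suc r % n) ≤ suc (cycNorm r) × cycNorm r ≤ suc (cycNorm (suc r % n))
  cycNorm-step r r<n with m≤n⇒m<n∨m≡n r<n
  ... | inj₁ 1+r<n rewrite m<n⇒m%n≡m 1+r<n = forward , backward
    where
    forward : suc r ⊓ (n ∸ suc r) ≤ suc (r ⊓ (n ∸ r))
    forward with ⊓-sel r (n ∸ r)
    ... | inj₁ e rewrite e = m⊓n≤m (suc r) _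
    ... | inj₂ e rewrite e = ≤-trans (m⊓n≤n (suc r) _) (≤-trans (∸-monoʳ-≤ n (n≤1+n r)) (n≤1+n _))
    backward : r ⊓ (n ∸ r) ≤ suc (suc r ⊓ (n ∸ suc r))
    backward with ⊓-sel (suc r) (n ∸ suc r)
    ... | inj₁ e rewrite e = ≤-trans (m⊓n≤m r _) (≤-trans (n≤1+n r) (n≤1+n _))
    ... | inj₂ e rewrite e = ≤-trans (m⊓n≤n r _) (≤-reflexive (∸-suc r<n))
  ... | inj₂ 1+r≡n = subst (λ z → cycNorm z ≤ suc (cycNorm r) × cycNorm r ≤ suc (cycNorm z)) (sym wraps)
    (z≤n , ≤-trans (m⊓n≤n r _) (≤-reflexive n∸r≡1))
    where
    wraps : suc r % n ≡ 0
    wraps = trans (cong (_% n) 1+r≡n) (n%n≡0 n)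
    n∸r≡1 : n ∸ r ≡ 1
    n∸r≡1 = trans (∸-suc r<n) (cong suc (trans (cong (n ∸_) 1+r≡n) (n∸n≡0 n)))

  cycDist-self : ∀ c → cycDist c c ≡ 0
  cycDist-self c = cong cycNorm (fwd-self c)

  cycDist-lipschitz : ∀ c → Lipschitz C (cycDist c)
  cycDist-lipschitz c a b e with C-adjacent⁻ a b e
  ... | inj₁ refl rewrite fwd-next c a = proj₁ (cycNorm-step (fwd c a) (fwd<n c a))
  ... | inj₂ refl rewrite fwd-next c b = proj₂ (cycNorm-step (fwd c b) (fwd<n c b))

  cycDist-≤-length : ∀ {c w k} → Walk C c w k → cycDist c w ≤ k
  cycDist-≤-length {c} = lipschitz⇒≤length₀ (cycDist-lipschitz c) (cycDist-self c)

  fwd-next-self : ∀ a → fwd a (next a) ≡ 1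
  fwd-next-self a = trans (fwd-⊕-self a 1) (m<n⇒m%n≡m {n = n} (s≤s (s≤s z≤n)))

  next-≢ : ∀ a → a ≢ next a
  next-≢ a a≡next with trans (sym (fwd-self a)) (trans (cong (fwd a) a≡next) (fwd-next-self a))
  ... | ()

  next²-≢ : ∀ a → a ≢ next (next a)
  next²-≢ a a≡next² with trans (sym (fwd-self a)) (trans (cong (fwd a) a≡next²)
                           (trans (fwd-⊕-self a 2) (m<n⇒m%n≡m {n = n} (s≤s (s≤s (s≤s z≤n))))))
  ... | ()

  C∖_ : Fin n → Adj (Fin n)
  C∖ a = deleteEdge decFin C a (next a)

  C∖-symmetric : ∀ a → Symmetricᵍ (C∖ a)
  C∖-symmetric a = deleteEdge-symmetric decFin C a (next a) C-symmetric

  C∖-next : ∀ a x → x ≢ a → (C∖ a) x (next x) ≡ true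
  C∖-next a x x≢a = deleteEdge⁺ decFin C a (next a) (C-next x) λ
    { (inj₁ (x≡a , _)) → x≢a x≡a
    ; (inj₂ (x≡next , next≡a)) → next²-≢ a (trans (sym next≡a) (cong next x≡next)) }

  forwardWalk∖ : ∀ a c r → (∀ i → i < r → c ⊕ i ≢ a) → Walk (C∖ a) c (c ⊕ r) r
  forwardWalk∖ a c zero avoids = nil
  forwardWalk∖ a c (suc r) avoids =
    snocʷ (forwardWalk∖ a c r (λ i i<r → avoids i (m<n⇒m<1+n i<r)))
      (C∖-next a (c ⊕ r) (avoids r ≤-refl))

  -- In C∖ a the cycle becomes a path from next a (position 0) to a (position n - 1).
  pos : Fin n → Fin n → ℕ
  pos a w = fwd (next a) w

  pos-end : ∀ a → pos a a ≡ n ∸ 1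
  pos-end a = trans (fwd-reverse a (next a) (next-≢ a)) (cong (n ∸_) (fwd-next-self a))

  pos-next : ∀ a w → w ≢ a → pos a (next w) ≡ suc (pos a w)
  pos-next a w w≢a with m≤n⇒m<n∨m≡n (fwd<n (next a) w)
  ... | inj₁ 1+pos<n = trans (fwd-next (next a) w) (m<n⇒m%n≡m 1+pos<n)
  ... | inj₂ 1+pos≡n =
    ⊥-elim (w≢a (fwd-injective (next a) (trans (suc-injective 1+pos≡n) (sym (pos-end a)))))

  pathDist : Fin n → Fin n → Fin n → ℕ
  pathDist a c w = ∣ pos a w - pos a c ∣

  pathDist-self : ∀ a c → pathDist a c c ≡ 0
  pathDist-self a c = ∣n-n∣≡0 (pos a c)

  pathDist-lipschitz : ∀ a c → Lipschitz (C∖ a) (pathDist a c)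
  pathDist-lipschitz a c x y e with deleteEdge⁻ decFin C a (next a) e
  ... | eC , ¬ends with C-adjacent⁻ x y eC
  ... | inj₁ refl rewrite pos-next a x (λ x≡a → ¬ends (inj₁ (x≡a , cong next x≡a))) =
    proj₁ (∣1+u-q∣-step (pos a x) (pos a c))
  ... | inj₂ refl rewrite pos-next a y (λ y≡a → ¬ends (inj₂ (cong next y≡a , y≡a))) =
    proj₂ (∣1+u-q∣-step (pos a y) (pos a c))

  pathDist-≤-length : ∀ {a c w k} → Walk (C∖ a) c w k → pathDist a c w ≤ k
  pathDist-≤-length {a} {c} = lipschitz⇒≤length₀ (pathDist-lipschitz a c) (pathDist-self a c)

  nonAntipodal⇒lengthened : ∀ a c → NonAntipodal n (pos a c) →
    Σ (Fin n) λ y → cycDist c y < pathDist a c y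
  nonAntipodal⇒lengthened a c (inj₁ n<2q) = next a , (begin-strict
    cycDist c (next a)  ≤⟨ m⊓n≤m (fwd c (next a)) _ ⟩
    fwd c (next a)      ≡⟨ fwd-reverse (next a) c next≢c ⟩
    n ∸ q               <⟨ ∸-monoˡ-< n<2q (<⇒≤ (fwd<n (next a) c)) ⟩
    q + q ∸ q           ≡⟨ m+n∸n≡m q q ⟩
    q                   ≡⟨ cong (λ z → ∣ z - q ∣) (fwd-self (next a)) ⟨
    pathDist a c (next a) ∎)
    where
    open ≤-Reasoning
    q : ℕ
    q = pos a c
    next≢c : next a ≢ c
    next≢c refl = n≮0 (subst (λ z → n < z + z) (fwd-self (next a)) n<2q)
  nonAntipodal⇒lengthened a c (inj₂ 2q+2<n) = a , (begin-strict
    cycDist c a         ≤⟨ m⊓n≤n o _ ⟩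
    n ∸ o               ≡⟨ cong (_∸ o) (cong suc q+o≡n-1) ⟨
    suc q + o ∸ o       ≡⟨ m+n∸n≡m (suc q) o ⟩
    suc q               <⟨ subst (_≤ o) (+-comm q 2) q+2≤o ⟩
    o                   ≡⟨ m+n∸m≡n q o ⟨
    q + o ∸ q           ≡⟨ cong (_∸ q) q+o≡n-1 ⟩
    n ∸ 1 ∸ q           ≡⟨ m≤n⇒∣n-m∣≡n∸m (subst (q ≤_) q+o≡n-1 (m≤m+n q o)) ⟨
    ∣ n ∸ 1 - q ∣        ≡⟨ cong (λ z → ∣ z - q ∣) (pos-end a) ⟨
    pathDist a c a      ∎)
    where
    open ≤-Reasoning
    q o : ℕ
    q = pos a c
    o = fwd c a
    q+o≡n-1 : q + o ≡ n ∸ 1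
    q+o≡n-1 with %-below-double n (q + o) (n ∸ 1) (+-mono-< (fwd<n (next a) c) (fwd<n c a))
                   (trans (fwd-trans (next a) c a) (pos-end a))
    ... | inj₁ q+o≡n-1 = q+o≡n-1
    ... | inj₂ q+o≡n+n-1 =
      ⊥-elim (<-irrefl q+o≡n+n-1 (+-mono-<-≤ (fwd<n (next a) c) (s≤s⁻¹ (fwd<n c a))))
    q+2≤o : q + 2 ≤ o
    q+2≤o = +-cancelˡ-≤ q (q + 2) o (≤-trans (≤-reflexive (sym (+-assoc q q 2)))
      (s≤s⁻¹ (subst (suc (q + q + 2) ≤_) (cong suc (sym q+o≡n-1)) 2q+2<n)))

  Spread : ℕ → Set
  Spread d = (2 ≤ d × d + 2 ≤ n) ⊎ n ≡ suc (d + d)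

  antipodal-pair-impossible : ∀ {d q} → Spread d → d < n → q < n →
    Antipodal n q → ¬ Antipodal n ((q + d) % n)
  antipodal-pair-impossible {d} {q} spread d<n q<n a₁ a₂
    with %-below-double n (q + d) ((q + d) % n) (+-mono-< q<n d<n) refl | spread
  ... | inj₁ q+d≡q′ | inj₁ (2≤d , _) = <-irrefl refl (≤-trans 2≤d (+-cancelˡ-≤ q d 1
    (≤-trans (≤-reflexive q+d≡q′) (≤-trans (antipodal-neighbours a₂ a₁) (≤-reflexive (+-comm 1 q))))))
  ... | inj₂ q+d≡n+q′ | inj₁ (_ , d+2≤n) =
    <-irrefl refl (+-cancelˡ-≤ d 2 1 (≤-trans d+2≤n (≤-trans n≤1+d (≤-reflexive (+-comm 1 d)))))
    where
    q′ : ℕ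
    q′ = (q + d) % n
    n≤1+d : n ≤ suc d
    n≤1+d = +-cancelʳ-≤ q′ n (suc d) (begin
      n + q′    ≡⟨ q+d≡n+q′ ⟨
      q + d     ≤⟨ +-monoˡ-≤ d (antipodal-neighbours a₁ a₂) ⟩
      suc q′ + d ≡⟨ cong suc (+-comm q′ d) ⟩
      suc d + q′ ∎)
      where open ≤-Reasoning
  ... | inj₁ q+d≡q′ | inj₂ n≡1+2d
    with antipodal-odd {d = d} q n≡1+2d a₁ | antipodal-odd {d = d} ((q + d) % n) n≡1+2d a₂
  ... | refl | q′≡d with +-cancelʳ-≡ q q 0 (trans q+d≡q′ q′≡d)
  ... | refl with n≡1+2d
  ... | ()
  antipodal-pair-impossible {d} {q} spread d<n q<n a₁ a₂
    | inj₂ q+d≡n+q′ | inj₂ n≡1+2d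
    with antipodal-odd {d = d} q n≡1+2d a₁ | antipodal-odd {d = d} ((q + d) % n) n≡1+2d a₂
  ... | refl | q′≡d = <-irrefl (+-cancelʳ-≡ d q n (trans q+d≡n+q′ (cong (n +_) q′≡d))) d<n

  nonAntipodal-one-of : ∀ a c {d} → d < n → Spread d →
    NonAntipodal n (pos a c) ⊎ NonAntipodal n (pos a (c ⊕ d))
  nonAntipodal-one-of a c {d} d<n spread with antipodal? n (pos a c) | antipodal? n (pos a (c ⊕ d))
  ... | inj₁ far | _ = inj₁ far
  ... | inj₂ _ | inj₁ far = inj₂ far
  ... | inj₂ a₁ | inj₂ a₂ = ⊥-elim (antipodal-pair-impossible spread d<n (fwd<n (next a) c) a₁
    (subst (Antipodal n) (fwd-⊕ (next a) c d) a₂))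

  half : ℕ
  half = n / 2

  n≡n%2+2half : n ≡ n % 2 + (half + half)
  n≡n%2+2half = trans (m≡m%n+[m/n]*n n 2)
    (cong (n % 2 +_) (trans (*-comm half 2) (cong (half +_) (+-identityʳ half))))

  n≤1+half+half : n ≤ suc (half + half)
  n≤1+half+half = subst (_≤ suc (half + half)) (sym n≡n%2+2half)
    (+-monoˡ-≤ (half + half) (s≤s⁻¹ (m%n<n n 2)))

  half+half≤n : half + half ≤ n
  half+half≤n = subst (half + half ≤_) (sym n≡n%2+2half) (m≤n+m (half + half) (n % 2))

  half≢0 : half ≢ 0
  half≢0 half≡0 with subst (λ h → n ≤ suc (h + h)) half≡0 n≤1+half+half
  ... | s≤s ()

  spread-half : Spread half
  spread-half = by-parity (n % 2) (m%n<n n 2) n≡n%2+2half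
    where
    by-parity : ∀ r → r < 2 → n ≡ r + (half + half) → Spread half
    by-parity zero _ n≡2h = inj₁ (2≤h , subst (half + 2 ≤_) (sym n≡2h) (+-monoʳ-≤ half 2≤h))
      where
      2≤h : 2 ≤ half
      2≤h = 3≤h+h⇒2≤h half (subst (3 ≤_) n≡2h (s≤s (s≤s (s≤s z≤n))))
    by-parity (suc zero) _ n≡1+2h = inj₂ n≡1+2h
    by-parity (suc (suc _)) (s≤s (s≤s ())) _

  half<n : half < n
  half<n = m/n<m n 2 (s≤s (s≤s z≤n))

  fwd-opposite : ∀ c → fwd c (c ⊕ half) ≡ half
  fwd-opposite c = trans (fwd-⊕-self c half) (m<n⇒m%n≡m half<n)

  avoiding-opposite-walk : ∀ c w → Walk (C∖ (c ⊕ half)) c w (cycDist c w)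
  avoiding-opposite-walk c w with fwd c w ≤? n ∸ fwd c w
  ... | yes r≤n∸r = subst (Walk _ c w) (sym (m≤n⇒m⊓n≡m r≤n∸r))
    (subst (λ z → Walk _ c z r) (⊕-fwd c w) (forwardWalk∖ (c ⊕ half) c r avoids))
    where
    r : ℕ
    r = fwd c w
    r≤half : r ≤ half
    r≤half = double-≤-cancel (≤-trans (+-monoʳ-≤ r r≤n∸r)
      (≤-trans (≤-reflexive (m+[n∸m]≡n (<⇒≤ (fwd<n c w)))) n≤1+half+half))
    avoids : ∀ i → i < r → c ⊕ i ≢ c ⊕ half
    avoids i i<r cᵢ≡opp = <-irrefl i≡half (≤-trans i<r r≤half)
      where
      i≡half : i ≡ half
      i≡half = trans (sym (m<n⇒m%n≡m (<-trans i<r (fwd<n c w))))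
        (trans (sym (fwd-⊕-self c i)) (trans (cong (fwd c) cᵢ≡opp) (fwd-opposite c)))
  ... | no r≰n∸r =
    subst (Walk _ c w) (trans (fwd-reverse c w c≢w) (sym (m≥n⇒m⊓n≡n (<⇒≤ (≰⇒> r≰n∸r)))))
    (reverseʷ (C∖-symmetric (c ⊕ half))
      (subst (λ z → Walk _ w z (fwd w c)) (⊕-fwd w c) (forwardWalk∖ (c ⊕ half) w (fwd w c) avoids)))
    where
    r : ℕ
    r = fwd c w
    c≢w : c ≢ w
    c≢w refl = r≰n∸r (subst (λ z → z ≤ n ∸ z) (sym (fwd-self c)) z≤n)
    n<r+r : n < r + r
    n<r+r = subst (_< r + r) (m∸n+n≡m (<⇒≤ (fwd<n c w))) (+-monoˡ-< r (≰⇒> r≰n∸r))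
    avoids : ∀ i → i < fwd w c → w ⊕ i ≢ c ⊕ half
    avoids i i<n∸r wᵢ≡opp =
      <-irrefl refl (<-≤-trans n<r+r (≤-trans (+-mono-≤ r≤half r≤half) half+half≤n))
      where
      r+i<n : r + i < n
      r+i<n = subst (r + i <_) (m+[n∸m]≡n (<⇒≤ (fwd<n c w)))
        (+-monoʳ-< r (subst (i <_) (fwd-reverse c w c≢w) i<n∸r))
      r+i≡half : r + i ≡ half
      r+i≡half = trans (sym (m<n⇒m%n≡m r+i<n))
        (trans (sym (fwd-⊕ c w i)) (trans (cong (fwd c) wᵢ≡opp) (fwd-opposite c)))
      r≤half : r ≤ half
      r≤half = subst (r ≤_) r+i≡half (m≤m+n r i)

  shortest-cycle-walk : ∀ c w → Walk C c w (cycDist c w)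
  shortest-cycle-walk c w =
    weakenʷ (deleteEdge⊆ decFin C (c ⊕ half) (next (c ⊕ half))) (avoiding-opposite-walk c w)

-- Cartesian products

module Product {m n : ℕ} (G : Adj (Fin m)) (H : Adj (Fin n)) where

  V : Set
  V = Fin m × Fin n

  P : Adj V
  P = prodFin G H

  P-adjacent⁻ : ∀ x z → P x z ≡ true →
    (G (proj₁ x) (proj₁ z) ≡ true × proj₂ x ≡ proj₂ z)
    ⊎ (proj₁ x ≡ proj₁ z × H (proj₂ x) (proj₂ z) ≡ true)
  P-adjacent⁻ (a , b) (c , d) e with ∨-true⁻ (G a c ∧ ⌊ b ≟ᶠ d ⌋) e
  ... | inj₁ step = let (eG , b≡d) = ∧-true⁻ (G a c) step in inj₁ (eG , isYes-true⁻ (b ≟ᶠ d) b≡d)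
  ... | inj₂ step = let (a≡c , eH) = ∧-true⁻ ⌊ a ≟ᶠ c ⌋ step in
    inj₂ (isYes-true⁻ (a ≟ᶠ c) a≡c , eH)

  P-step₁ : ∀ {a c} b → G a c ≡ true → P (a , b) (c , b) ≡ true
  P-step₁ b e rewrite e with b ≟ᶠ b
  ... | yes _ = refl
  ... | no b≢b = ⊥-elim (b≢b refl)

  P-step₂ : ∀ a {b d} → H b d ≡ true → P (a , b) (a , d) ≡ true
  P-step₂ a e rewrite e with a ≟ᶠ a
  ... | yes _ = ∨-zeroʳ _
  ... | no a≢a = ⊥-elim (a≢a refl)

  Split : V → V → ℕ → Set
  Split x y j = Σ ℕ λ a → Σ ℕ λ b →
    Walk G (proj₁ x) (proj₁ y) a × Walk H (proj₂ x) (proj₂ y) b × a + b ≡ j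

  split : ∀ {x y j} → Walk P x y j → Split x y j
  split nil = 0 , 0 , nil , nil , refl
  split (cons {x} {z} e w) with split w | P-adjacent⁻ x z e
  ... | a , b , wG , wH , a+b≡j | inj₁ (eG , refl) = suc a , b , cons eG wG , wH , cong suc a+b≡j
  ... | a , b , wG , wH , a+b≡j | inj₂ (refl , eH) =
    a , suc b , wG , cons eH wH , trans (+-suc a b) (cong suc a+b≡j)

  module FiberEdgeDeletion (t : Fin m) (u v : Fin n) where

    B : Adj V
    B = deleteEdge decFinPair P (t , u) (t , v)

    H∖ : Adj (Fin n)
    H∖ = deleteEdge decFin H u v

    B⊆P : B ⊆ᵍ P
    B⊆P = deleteEdge⊆ decFinPair P (t , u) (t , v)

    ends-in-fiber : ∀ {x z} → Ends (t , u) (t , v) x z → proj₁ x ≡ t × proj₁ z ≡ t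
    ends-in-fiber (inj₁ (refl , refl)) = refl , refl
    ends-in-fiber (inj₂ (refl , refl)) = refl , refl

    B-step₁ : (∀ {a} → G a a ≢ true) → ∀ {a c} w → G a c ≡ true → B (a , w) (c , w) ≡ true
    B-step₁ loopless w e = deleteEdge⁺ decFinPair P (t , u) (t , v) (P-step₁ w e) λ ends →
      let (a≡t , c≡t) = ends-in-fiber ends in
      loopless (subst₂ (λ p q → G p q ≡ true) (trans a≡t (sym c≡t)) refl e)

    B-step₂ : ∀ {s b d} → s ≢ t → H b d ≡ true → B (s , b) (s , d) ≡ true
    B-step₂ {s} s≢t e = deleteEdge⁺ decFinPair P (t , u) (t , v) (P-step₂ s e)
      λ ends → s≢t (proj₁ (ends-in-fiber ends))

    B-step∖ : ∀ {b d} → H∖ b d ≡ true → B (t , b) (t , d) ≡ true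
    B-step∖ e with deleteEdge⁻ decFin H u v e
    ... | eH , ¬ends = deleteEdge⁺ decFinPair P (t , u) (t , v) (P-step₂ t eH) λ
      { (inj₁ (p , q)) → ¬ends (inj₁ (cong proj₂ p , cong proj₂ q))
      ; (inj₂ (p , q)) → ¬ends (inj₂ (cong proj₂ p , cong proj₂ q)) }

    FiberSplit : V → V → ℕ → Set
    FiberSplit x y j = (Σ ℕ λ b → b < j × Walk H (proj₂ x) (proj₂ y) b)
      ⊎ (proj₁ x ≡ proj₁ y × (proj₁ x ≡ t → Walk H∖ (proj₂ x) (proj₂ y) j))

    splitᴮ : ∀ {x y j} → Walk B x y j → FiberSplit x y j
    splitᴮ nil = inj₂ (refl , λ _ → nil)
    splitᴮ (cons {x} {z} e w) with deleteEdge⁻ decFinPair P (t , u) (t , v) e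
    ... | eP , ¬ends with P-adjacent⁻ x z eP
    ... | inj₁ (_ , refl) with split (weakenʷ B⊆P w)
    ... | a , b , _ , wH , a+b≡j = inj₁ (b , s≤s (≤-trans (m≤n+m b a) (≤-reflexive a+b≡j)) , wH)
    splitᴮ (cons e w) | eP , ¬ends | inj₂ (refl , eH) with splitᴮ w
    ... | inj₁ (b , b<j , wH) = inj₁ (suc b , s≤s b<j , cons eH wH)
    ... | inj₂ (refl , inFiber) = inj₂ (refl , λ { refl →
      cons (deleteEdge⁺ decFin H u v eH λ ends → ¬ends (lift ends)) (inFiber refl) })
      where
      lift : ∀ {b d} → Ends u v b d → Ends (t , u) (t , v) (t , b) (t , d)
      lift (inj₁ (refl , refl)) = inj₁ (refl , refl)
      lift (inj₂ (refl , refl)) = inj₂ (refl , refl)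

  module LayerEdgeDeletion (c₀ : Fin n) (t t′ : Fin m) where

    B : Adj V
    B = deleteEdge decFinPair P (t , c₀) (t′ , c₀)

    G∖ : Adj (Fin m)
    G∖ = deleteEdge decFin G t t′

    B⊆P : B ⊆ᵍ P
    B⊆P = deleteEdge⊆ decFinPair P (t , c₀) (t′ , c₀)

    ends-in-layer : ∀ {x z} → Ends (t , c₀) (t′ , c₀) x z →
      proj₂ x ≡ c₀ × (proj₁ x ≡ proj₁ z → t ≡ t′)
    ends-in-layer (inj₁ (refl , refl)) = refl , id
    ends-in-layer (inj₂ (refl , refl)) = refl , sym

    B-step₁ : ∀ {a c w} → w ≢ c₀ → G a c ≡ true → B (a , w) (c , w) ≡ true
    B-step₁ {w = w} w≢c₀ e = deleteEdge⁺ decFinPair P (t , c₀) (t′ , c₀) (P-step₁ w e)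
      λ ends → w≢c₀ (proj₁ (ends-in-layer ends))

    B-step₂ : ∀ {s b d} → t ≢ t′ → H b d ≡ true → B (s , b) (s , d) ≡ true
    B-step₂ {s} t≢t′ e = deleteEdge⁺ decFinPair P (t , c₀) (t′ , c₀) (P-step₂ s e)
      λ ends → t≢t′ (proj₂ (ends-in-layer ends) refl)

    LayerSplit : V → V → ℕ → Set
    LayerSplit x y j = (Σ ℕ λ a → a < j × Walk G (proj₁ x) (proj₁ y) a)
      ⊎ (proj₂ x ≡ proj₂ y × (proj₂ x ≡ c₀ → Walk G∖ (proj₁ x) (proj₁ y) j))

    splitᴮ : ∀ {x y j} → Walk B x y j → LayerSplit x y j
    splitᴮ nil = inj₂ (refl , λ _ → nil)
    splitᴮ (cons {x} {z} e w) with deleteEdge⁻ decFinPair P (t , c₀) (t′ , c₀) e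
    ... | eP , ¬ends with P-adjacent⁻ x z eP
    ... | inj₂ (refl , _) with split (weakenʷ B⊆P w)
    ... | a , b , wG , _ , a+b≡j = inj₁ (a , s≤s (≤-trans (m≤m+n a b) (≤-reflexive a+b≡j)) , wG)
    splitᴮ (cons e w) | eP , ¬ends | inj₁ (eG , refl) with splitᴮ w
    ... | inj₁ (a , a<j , wG) = inj₁ (suc a , s≤s a<j , cons eG wG)
    ... | inj₂ (refl , inLayer) = inj₂ (refl , λ { refl →
      cons (deleteEdge⁺ decFin G t t′ eG λ ends → ¬ends (lift ends)) (inLayer refl) })
      where
      lift : ∀ {a b} → Ends t t′ a b → Ends (t , c₀) (t′ , c₀) (a , c₀) (b , c₀)
      lift (inj₁ (refl , refl)) = inj₁ (refl , refl)
      lift (inj₂ (refl , refl)) = inj₂ (refl , refl)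

-- Vertex sets of Fin m × Fin n

module Covering (m k : ℕ) where

  open Cycle k

  V : Set
  V = Fin m × Fin n

  MeetsEveryLayer : List V → Set
  MeetsEveryLayer M = ∀ c → Σ (Fin m) λ t → (t , c) ∈ M

  record SpreadPairIn (M : List V) (t : Fin m) : Set where
    field
      base : Fin n
      gap : ℕ
      base∈M : (t , base) ∈ M
      shifted∈M : (t , base ⊕ gap) ∈ M
      gap<n : gap < n
      spread : Spread gap

  record TwoIn (M : List V) (t : Fin m) : Set where
    field
      first second : Fin n
      first∈M : (t , first) ∈ M
      second∈M : (t , second) ∈ M
      first≢second : first ≢ second

  select : (Fin m → Fin n) → (Fin m → Fin n) → Fin 2 → Fin m → Fin n
  select c c′ zero = c
  select c c′ (suc zero) = c′

  choose : (Fin m → Fin n) → (Fin m → Fin n) → Fin 2 × Fin m → V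
  choose c c′ (b , t) = t , select c c′ b t

  choose-injective : ∀ {c c′} → (∀ t → c t ≢ c′ t) → ∀ {i j} →
    choose c c′ i ≡ choose c c′ j → i ≡ j
  choose-injective {c} {c′} c≢c′ {b , t} {b′ , t′} eq with cong proj₁ eq
  ... | refl = cong (_, t) (bit b b′ (cong proj₂ eq))
    where
    bit : ∀ b b′ → proj₂ (choose c c′ (b , t)) ≡ proj₂ (choose c c′ (b′ , t)) → b ≡ b′
    bit zero zero _ = refl
    bit (suc zero) (suc zero) _ = refl
    bit zero (suc zero) c≡c′ = ⊥-elim (c≢c′ t c≡c′)
    bit (suc zero) zero c′≡c = ⊥-elim (c≢c′ t (sym c′≡c))

  meetsEveryLayer⇒n≤length : ∀ M → MeetsEveryLayer M → n ≤ length M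
  meetsEveryLayer⇒n≤length M layer =
    injective-into-list⇒≤length (λ c → proj₁ (layer c) , c) (cong proj₂) (λ c → proj₂ (layer c))

  twoInEveryFiber⇒2m≤length : ∀ M → (∀ t → TwoIn M t) → 2 * m ≤ length M
  twoInEveryFiber⇒2m≤length M two =
    injective-into-list⇒≤length (λ i → choose first second (remQuot {2} m i))
    (λ eq → remQuot-injective m (choose-injective (λ t → TwoIn.first≢second (two t)) eq))
    (λ i → chosen∈M (remQuot {2} m i))
    where
    first second : Fin m → Fin n
    first t = TwoIn.first (two t)
    second t = TwoIn.second (two t)
    chosen∈M : ∀ i → choose first second i ∈ M
    chosen∈M (zero , t) = TwoIn.first∈M (two t)
    chosen∈M (suc zero , t) = TwoIn.second∈M (two t)

  module _ .{{_ : NonZero m}} where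

    diagonalVertex : Fin n → V
    diagonalVertex c = toℕ c mod m , c

    diagonal : List V
    diagonal = tabulate diagonalVertex

    diagonal-unique : Unique diagonal
    diagonal-unique = tabulate⁺ {f = diagonalVertex} (cong proj₂)

    diagonal-meets-layers : MeetsEveryLayer diagonal
    diagonal-meets-layers c = toℕ c mod m , ∈-tabulate⁺ {f = diagonalVertex} c

    ∈-diagonal : ∀ t c → toℕ c % m ≡ toℕ t → (t , c) ∈ diagonal
    ∈-diagonal t c c%m≡t = subst (λ s → (s , c) ∈ diagonal)
      (toℕ-injective (trans (toℕ-mod m (toℕ c)) c%m≡t))
      (∈-tabulate⁺ {f = diagonalVertex} c)

    diagonal-spread : 2 ≤ m → 2 * m + 1 ≤ n → ∀ t → SpreadPairIn diagonal t
    diagonal-spread 2≤m 2m<n t = record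
      { base = c
      ; gap = m
      ; base∈M = ∈-diagonal t c (trans (cong (_% m) toℕ-c) (m<n⇒m%n≡m t<m))
      ; shifted∈M = ∈-diagonal t (c ⊕ m)
          (trans (cong (_% m) toℕ-c⊕m) (trans ([m+n]%n≡m%n (toℕ t) m) (m<n⇒m%n≡m t<m)))
      ; gap<n = ≤-<-trans (m≤m+n m m) m+m<n
      ; spread = inj₁ (2≤m , ≤-trans (+-monoʳ-≤ m 2≤m) (<⇒≤ m+m<n))
      }
      where
      c : Fin n
      c = toℕ t mod n
      t<m : toℕ t < m
      t<m = toℕ<n t
      m+m<n : m + m < n
      m+m<n = subst (_< n) (cong (m +_) (+-identityʳ m)) (subst (_≤ n) (+-comm (2 * m) 1) 2m<n)
      toℕ-c : toℕ c ≡ toℕ t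
      toℕ-c = trans (toℕ-mod n (toℕ t)) (m<n⇒m%n≡m (<-trans t<m (≤-<-trans (m≤m+n m m) m+m<n)))
      toℕ-c⊕m : toℕ (c ⊕ m) ≡ toℕ t + m
      toℕ-c⊕m = trans (toℕ-⊕ c m) (trans (cong (λ z → (z + m) % n) toℕ-c)
        (m<n⇒m%n≡m (≤-<-trans (+-monoˡ-≤ m (<⇒≤ t<m)) m+m<n)))

  lower upper : Fin m → Fin n
  lower t = toℕ t mod n
  upper t = lower t ⊕ half

  lower≢upper : ∀ t → lower t ≢ upper t
  lower≢upper t l≡u = half≢0 (trans (sym (fwd-opposite (lower t)))
    (trans (cong (fwd (lower t)) (sym l≡u)) (fwd-self (lower t))))

  pairVertex : Fin (2 * m) → V
  pairVertex i = choose lower upper (remQuot {2} m i)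

  pairs : List V
  pairs = tabulate pairVertex

  pairs-unique : Unique pairs
  pairs-unique = tabulate⁺ {f = pairVertex} λ eq → remQuot-injective m (choose-injective lower≢upper eq)

  ∈-pairs : ∀ b t → choose lower upper (b , t) ∈ pairs
  ∈-pairs b t = subst (_∈ pairs) (cong (choose lower upper) (remQuot-combine b t))
    (∈-tabulate⁺ {f = pairVertex} (combine b t))

  pairs-spread : ∀ t → SpreadPairIn pairs t
  pairs-spread t = record
    { base = lower t ; gap = half ; base∈M = ∈-pairs zero t ; shifted∈M = ∈-pairs (suc zero) t
    ; gap<n = half<n ; spread = spread-half }

  pairs-meets-layers : n ≤ 2 * m → MeetsEveryLayer pairs
  pairs-meets-layers n≤2m c with toℕ c <? m
  ... | yes c<m = t , subst (λ z → (t , z) ∈ pairs) lower≡c (∈-pairs zero t)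
    where
    t : Fin m
    t = fromℕ< c<m
    lower≡c : lower t ≡ c
    lower≡c = toℕ-injective (begin
      toℕ (lower t) ≡⟨ toℕ-mod n (toℕ t) ⟩
      toℕ t % n     ≡⟨ cong (_% n) (toℕ-fromℕ< c<m) ⟩
      toℕ c % n     ≡⟨ toℕ%n c ⟩
      toℕ c         ∎)
      where open ≡-Reasoning
  ... | no c≮m = t , subst (λ z → (t , z) ∈ pairs) upper≡c (∈-pairs (suc zero) t)
    where
    n≤m+m : n ≤ m + m
    n≤m+m = subst (n ≤_) (cong (m +_) (+-identityʳ m)) n≤2m
    half≤c : half ≤ toℕ c
    half≤c = ≤-trans (double-≤-cancel (≤-trans half+half≤n (≤-trans n≤m+m (n≤1+n (m + m))))) (≮⇒≥ c≮m)
    n≤m+half : n ≤ m + half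
    n≤m+half with half <? m
    ... | yes half<m = ≤-trans n≤1+half+half (+-monoˡ-≤ half half<m)
    ... | no half≮m = ≤-trans n≤m+m (+-monoʳ-≤ m (≮⇒≥ half≮m))
    c∸half<m : toℕ c ∸ half < m
    c∸half<m = subst (toℕ c ∸ half <_) (m+n∸n≡m m half)
      (∸-monoˡ-< (<-≤-trans (toℕ<n c) n≤m+half) half≤c)
    t : Fin m
    t = fromℕ< c∸half<m
    upper≡c : upper t ≡ c
    upper≡c = toℕ-injective (begin
      toℕ (lower t ⊕ half)            ≡⟨ toℕ-⊕ (lower t) half ⟩
      (toℕ (lower t) + half) % n      ≡⟨ cong (λ z → (z + half) % n) (toℕ-mod n (toℕ t)) ⟩
      (toℕ t % n + half) % n          ≡⟨ [a%n+b]%n≡[a+b]%n n (toℕ t) half ⟩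
      (toℕ t + half) % n              ≡⟨ cong (λ z → (z + half) % n) (toℕ-fromℕ< c∸half<m) ⟩
      (toℕ c ∸ half + half) % n       ≡⟨ cong (_% n) (m∸n+n≡m half≤c) ⟩
      toℕ c % n                       ≡⟨ toℕ%n c ⟩
      toℕ c                           ∎)
      where open ≡-Reasoning

-- Monitoring the edges of T □ C_n

module TreeCycle {m : ℕ} {T : Adj (Fin m)} (tree : IsTree T) (k : ℕ) where

  open Cycle k
  open Product T C
  open Covering m k hiding (V)

  Monitorsᴾ : V → V → V → Set
  Monitorsᴾ = Monitorsᵉ decFinPair P

  T-loopless : ∀ {a} → T a a ≢ true
  T-loopless = loopless (proj₁ tree)

  cycDist-≤-product-length : ∀ {c y j} → Walk P c y j → cycDist (proj₂ c) (proj₂ y) ≤ j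
  cycDist-≤-product-length {c} w with split w
  ... | a , b , _ , wC , a+b≡j = ≤-trans (cycDist-≤-length wC)
    (≤-trans (m≤n+m b a) (≤-reflexive a+b≡j))

  fiber-edge-unmonitored-outside : ∀ {t u v s c} → s ≢ t → ¬ Monitorsᴾ (s , c) (t , u) (t , v)
  fiber-edge-unmonitored-outside {t} {u} {v} {s} {c} s≢t = unmonitored-if-shortcuts decFinPair P shortcut
    where
    open FiberEdgeDeletion t u v
    shortcut : ∀ y j → Walk P (s , c) y j → Σ ℕ λ j′ → j′ ≤ j × Walk B (s , c) y j′
    shortcut y j w with split w
    ... | a , b , wT , wC , a+b≡j = b + a , ≤-reflexive (trans (+-comm b a) a+b≡j) ,
      mapʷ (s ,_) (λ _ _ → B-step₂ s≢t) wC
        ++ʷ mapʷ (_, proj₂ y) (λ _ _ → B-step₁ T-loopless (proj₂ y)) wT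

  opposite-edge-unmonitored : ∀ t c → ¬ Monitorsᴾ (t , c) (t , c ⊕ half) (t , next (c ⊕ half))
  opposite-edge-unmonitored t c = unmonitored-if-shortcuts decFinPair P shortcut
    where
    open FiberEdgeDeletion t (c ⊕ half) (next (c ⊕ half))
    shortcut : ∀ y j → Walk P (t , c) y j → Σ ℕ λ j′ → j′ ≤ j × Walk B (t , c) y j′
    shortcut y j w with split w
    ... | a , b , wT , wC , a+b≡j = cycDist c (proj₂ y) + a ,
      ≤-trans (+-monoˡ-≤ a (cycDist-≤-length wC))
        (≤-reflexive (trans (+-comm b a) a+b≡j)) ,
      mapʷ (t ,_) (λ _ _ → B-step∖) (avoiding-opposite-walk c (proj₂ y))
        ++ʷ mapʷ (_, proj₂ y) (λ _ _ → B-step₁ T-loopless (proj₂ y)) wT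

  layer-edge-unmonitored-outside : ∀ {c₀ t t′ s c} → T t t′ ≡ true → c ≢ c₀ →
    ¬ Monitorsᴾ (s , c) (t , c₀) (t′ , c₀)
  layer-edge-unmonitored-outside {c₀} {t} {t′} {s} {c} e c≢c₀ =
    unmonitored-if-shortcuts decFinPair P shortcut
    where
    open LayerEdgeDeletion c₀ t t′
    t≢t′ : t ≢ t′
    t≢t′ refl = T-loopless e
    shortcut : ∀ y j → Walk P (s , c) y j → Σ ℕ λ j′ → j′ ≤ j × Walk B (s , c) y j′
    shortcut y j w with split w | proj₂ y ≟ᶠ c₀
    ... | a , b , wT , wC , a+b≡j | yes _ = a + b , ≤-reflexive a+b≡j ,
      mapʷ (_, c) (λ _ _ → B-step₁ c≢c₀) wT ++ʷ mapʷ (proj₁ y ,_) (λ _ _ → B-step₂ t≢t′) wC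
    ... | a , b , wT , wC , a+b≡j | no y₂≢c₀ = b + a , ≤-reflexive (trans (+-comm b a) a+b≡j) ,
      mapʷ (s ,_) (λ _ _ → B-step₂ t≢t′) wC ++ʷ mapʷ (_, proj₂ y) (λ _ _ → B-step₁ y₂≢c₀) wT

  fiber-edge-monitored : ∀ t a c → NonAntipodal n (pos a c) → Monitorsᴾ (t , c) (t , a) (t , next a)
  fiber-edge-monitored t a c far with nonAntipodal⇒lengthened a c far
  ... | y , cycDist<pathDist = (t , y) , ¬SameDist geodesic no-walk
    where
    open FiberEdgeDeletion t a (next a)
    geodesic : Dist P (t , c) (t , y) (cycDist c y)
    geodesic = mapʷ (t ,_) (λ _ _ → P-step₂ t) (shortest-cycle-walk c y) ,
      λ j j<d w → <-irrefl refl (<-≤-trans j<d (cycDist-≤-product-length w))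
    no-walk : ¬ Walk B (t , c) (t , y) (cycDist c y)
    no-walk w with splitᴮ w
    ... | inj₁ (b , b<d , wC) = <-irrefl refl (≤-<-trans (cycDist-≤-length wC) b<d)
    ... | inj₂ (_ , inFiber) = <-irrefl refl (<-≤-trans cycDist<pathDist
      (pathDist-≤-length (inFiber refl)))

  tree-geodesic : ∀ s t → Σ ℕ (Dist T s t)
  tree-geodesic s t = shortestWalk T (proj₂ (proj₁ (proj₂ tree) s t))

  -- Seen from s, the edge t t′ of the tree is a bridge whose far end t′ can only be reached through t.
  layer-edge-monitored-towards-far-end : ∀ {c₀ t t′ s d d′} → T t t′ ≡ true →
    Dist T s t d → Dist T s t′ d′ → d ≤ d′ → Monitorsᴾ (s , c₀) (t , c₀) (t′ , c₀)
  layer-edge-monitored-towards-far-end {c₀} {t} {t′} {s} {d′ = d′} e dist dist′ d≤d′ =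
    (t′ , c₀) , ¬SameDist geodesic no-walk
    where
    open LayerEdgeDeletion c₀ t t′
    geodesic : Dist P (s , c₀) (t′ , c₀) d′
    geodesic = mapʷ (_, c₀) (λ _ _ → P-step₁ c₀) (proj₁ dist′) , λ j j<d′ w →
      let (a , b , wT , _ , a+b≡j) = split w in
      proj₂ dist′ a (≤-<-trans (≤-trans (m≤m+n a b) (≤-reflexive a+b≡j)) j<d′) wT
    no-walk : ¬ Walk B (s , c₀) (t′ , c₀) d′
    no-walk w with splitᴮ w
    ... | inj₁ (a , a<d′ , wT) = proj₂ dist′ a a<d′ wT
    ... | inj₂ (_ , inLayer) with avoids-or-reaches decFin T t t′ (proj₁ dist)
    ... | inj₁ s→t = tree-edge-is-bridge tree e (reverseʷ T∖-symmetric s→t ++ʷ inLayer refl)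
      where
      T∖-symmetric : Symmetricᵍ (deleteEdge decFin T t t′)
      T∖-symmetric = deleteEdge-symmetric decFin T t t′ (simple⇒symmetric (proj₁ tree))
    ... | inj₂ (p , p<d , inj₁ s→t) = proj₂ dist p p<d s→t
    ... | inj₂ (p , p<d , inj₂ s→t′) = proj₂ dist′ p (<-≤-trans p<d d≤d′) s→t′

  layer-edge-monitored : ∀ {c₀ t t′} → T t t′ ≡ true → ∀ s →
    Monitorsᴾ (s , c₀) (t , c₀) (t′ , c₀)
  layer-edge-monitored {c₀} {t} {t′} e s with tree-geodesic s t | tree-geodesic s t′
  ... | d , dist | d′ , dist′ with d ≤? d′
  ... | yes d≤d′ = layer-edge-monitored-towards-far-end e dist dist′ d≤d′
  ... | no d≰d′ = monitors-swap decFinPair P (layer-edge-monitored-towards-far-end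
    (simple⇒symmetric (proj₁ tree) t t′ e) dist′ dist (<⇒≤ (≰⇒> d≰d′)))

  spread-pair-monitors : ∀ {M t} → SpreadPairIn M t → ∀ a →
    Σ V λ x → x ∈ M × Monitorsᴾ x (t , a) (t , next a)
  spread-pair-monitors {t = t} record
    { base = c ; gap = d ; base∈M = c∈M ; shifted∈M = c⊕d∈M ; gap<n = d<n ; spread = spread } a
    with nonAntipodal-one-of a c d<n spread
  ... | inj₁ far = (t , c) , c∈M , fiber-edge-monitored t a c far
  ... | inj₂ far = (t , c ⊕ d) , c⊕d∈M , fiber-edge-monitored t a (c ⊕ d) far

  isDEMSet-if-layers-and-spread-pairs : ∀ M → MeetsEveryLayer M → (∀ t → SpreadPairIn M t) →
    IsDEMSet decFinPair P M
  isDEMSet-if-layers-and-spread-pairs M layer pair (x , z , e) with P-adjacent⁻ x z e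
  ... | inj₁ (eT , refl) = let (s , s∈M) = layer (proj₂ x) in (s , proj₂ x) , s∈M , layer-edge-monitored eT s
  ... | inj₂ (refl , eC) with C-adjacent⁻ (proj₂ x) (proj₂ z) eC
  ... | inj₁ refl = spread-pair-monitors (pair (proj₁ x)) (proj₂ x)
  ... | inj₂ refl = let (y , y∈M , mon) = spread-pair-monitors (pair (proj₁ x)) (proj₂ z) in
    y , y∈M , monitors-swap decFinPair P mon

  every-layer-met : ∀ {t t′} → T t t′ ≡ true → ∀ M → IsDEMSet decFinPair P M → MeetsEveryLayer M
  every-layer-met {t} {t′} e M dem c with dem ((t , c) , (t′ , c) , P-step₁ c e)
  ... | (s , c′) , x∈M , mon with c′ ≟ᶠ c
  ... | yes refl = s , x∈M
  ... | no c′≢c = ⊥-elim (layer-edge-unmonitored-outside e c′≢c mon)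

  fiber-edge-monitor : ∀ M → IsDEMSet decFinPair P M → ∀ t a →
    Σ (Fin n) λ c → (t , c) ∈ M × Monitorsᴾ (t , c) (t , a) (t , next a)
  fiber-edge-monitor M dem t a with dem ((t , a) , (t , next a) , P-step₂ t (C-next a))
  ... | (s , c) , x∈M , mon with s ≟ᶠ t
  ... | yes refl = c , x∈M , mon
  ... | no s≢t = ⊥-elim (fiber-edge-unmonitored-outside s≢t mon)

  -- The edge opposite to the first monitor of a fiber needs a second one.
  two-in-every-fiber : ∀ M → IsDEMSet decFinPair P M → ∀ t → TwoIn M t
  two-in-every-fiber M dem t with fiber-edge-monitor M dem t zero
  ... | c , c∈M , _ with fiber-edge-monitor M dem t (c ⊕ half)
  ... | c′ , c′∈M , mon′ = record
    { first = c ; second = c′ ; first∈M = c∈M ; second∈M = c′∈M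
    ; first≢second = λ { refl → opposite-edge-unmonitored t c mon′ } }

mainTheorem13 : (m n : ℕ) → 2 ≤ m → 3 ≤ n → (T : Adj (Fin m)) → IsTree T →
    (2 * m + 1 ≤ n → DemIs decFinPair (prodFin T (cycleAdj n)) n)
    × (n ≤ 2 * m → DemIs decFinPair (prodFin T (cycleAdj n)) (2 * m))
mainTheorem13 m@(suc (suc _)) (suc (suc (suc k))) 2≤m@(s≤s (s≤s _)) (s≤s (s≤s (s≤s _))) T tree =
  sparse , dense
  where
  open Cycle k
  open Covering m k
  open TreeCycle tree k using (isDEMSet-if-layers-and-spread-pairs; every-layer-met; two-in-every-fiber)
  tree-edge : Σ (Fin m) λ t → Σ (Fin m) λ t′ → T t t′ ≡ true
  tree-edge = connected⇒edge (proj₁ (proj₂ tree)) {zero} {suc zero} λ ()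
  sparse : 2 * m + 1 ≤ n → DemIs decFinPair (prodFin T C) n
  sparse 2m<n =
    ( diagonal , diagonal-unique
    , isDEMSet-if-layers-and-spread-pairs diagonal diagonal-meets-layers (diagonal-spread 2≤m 2m<n)
    , length-tabulate diagonalVertex )
    , λ M _ dem → meetsEveryLayer⇒n≤length M (every-layer-met (proj₂ (proj₂ tree-edge)) M dem)
  dense : n ≤ 2 * m → DemIs decFinPair (prodFin T C) (2 * m)
  dense n≤2m =
    ( pairs , pairs-unique
    , isDEMSet-if-layers-and-spread-pairs pairs (pairs-meets-layers n≤2m) pairs-spread
    , length-tabulate pairVertex )
    , λ M _ dem → twoInEveryFiber⇒2m≤length M (two-in-every-fiber M dem)
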